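{- If a matroid $M$ is delta-graphic, then so is its dual $M^{*}$.
   Context: Graphs are finite and may have loops and parallel edges. A graft is a pair $(G,T)$ of a graph $G$ and a subset $T\subseteq V(G)$. A subgraph $H$ of $G$ is $T$-spanning if $V(H)=V(G)$ and every component $C$ of $H$ satisfies either (i) $|V(C)\cap T|$ is odd, or (ii) $V(C)\cap T=\emptyset$ and $G[V(C)]$ is a component of $G$. A set $F\subseteq E(G)$ is feasible in $(G,T)$ if it is the edge set of a $T$-spanning forest of $G$; let $\mathcal{F}(G,T)$ denote the set of feasible sets. For a family $\mathcal{F}$ of sets and a set $X$, write $\mathcal{F}\triangle X=\{F\triangle X: F\in\mathcal{F}\}$. A matroid $M$ is delta-graphic if there exist a graft $(G,T)$ with $E(G)=E(M)$ and a set $X\subseteq E(G)$ such that the set of bases of $M$ equals $\mathcal{F}(G,T)\triangle X$. -}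

module Defs where

open import Data.Nat using (ℕ; _%_)
open import Data.Fin using (Fin)
open import Data.Fin.Subset using (Subset; _∈_; _∉_; _∩_; _∪_; ∁; ⁅_⁆; _-_; ∣_∣; ⊥; ⊤)
open import Data.Bool using (_xor_)
open import Data.Vec using (zipWith)
open import Data.Product using (_×_; _,_; Σ; ∃; ∃-syntax)
open import Data.Sum using (_⊎_)
open import Data.List using (List; []; _∷_)
open import Data.List.Relation.Unary.Unique.Propositional using (Unique)
open import Relation.Binary.PropositionalEquality using (_≡_; _≢_)
open import Relation.Nullary using (¬_)
open import Function.Bundles using (_⇔_)

record IsMatroidBases {m : ℕ} (Base : Subset m → Set) : Set where
  field
    base-exists : ∃[ B ] Base B
    exchange    : ∀ B₁ B₂ → Base B₁ → Base B₂ → ∀ x → x ∈ B₁ → x ∉ B₂ →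
                  ∃[ y ] (y ∈ B₂ × y ∉ B₁ × Base ((B₁ - x) ∪ ⁅ y ⁆))

record Matroid (m : ℕ) : Set₁ where
  field
    Base       : Subset m → Set
    isMatroid  : IsMatroidBases Base
open Matroid public

DualBase : ∀ {m} → Matroid m → Subset m → Set
DualBase M B = Base M (∁ B)

-- Graphs with vertex set Fin n and edge set Fin m (loops and parallel
-- edges allowed): each edge has an (unordered) pair of ends.

record Graph (n m : ℕ) : Set where
  field
    ends : Fin m → Fin n × Fin n
open Graph public

Joins : ∀ {n m} → Graph n m → Fin m → Fin n → Fin n → Set
Joins G e u w = (ends G e ≡ (u , w)) ⊎ (ends G e ≡ (w , u))

-- Walks from u to v using only edges satisfying P; indexed by the list
-- of edges traversed and the list of vertices left (all but the last).
data Walk {n m} (G : Graph n m) (P : Fin m → Set) :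
          Fin n → Fin n → List (Fin m) → List (Fin n) → Set where
  stop : ∀ {u} → Walk G P u u [] []
  step : ∀ {u w v e es vs} → P e → Joins G e u w →
         Walk G P w v es vs → Walk G P u v (e ∷ es) (u ∷ vs)

Connected : ∀ {n m} → Graph n m → (Fin m → Set) → Fin n → Fin n → Set
Connected G P u v = ∃[ es ] ∃[ vs ] Walk G P u v es vs

-- A cycle with all edges in F: a closed walk of positive length with
-- distinct edges and distinct vertices v₀,…,v_{k-1}.
HasCycleIn : ∀ {n m} → Graph n m → Subset m → Set
HasCycleIn G F = ∃[ v ] ∃[ es ] ∃[ vs ]
  (Walk G (_∈ F) v v es vs × es ≢ [] × Unique es × Unique vs)

IsForest : ∀ {n m} → Graph n m → Subset m → Set
IsForest G F = ¬ HasCycleIn G F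

IsComponent : ∀ {n m} → Graph n m → Subset m → Subset n → Set
IsComponent G F S = ∃[ v ] (∀ u → (u ∈ S) ⇔ Connected G (_∈ F) v u)

IsComponentOfG : ∀ {n m} → Graph n m → Subset n → Set
IsComponentOfG G S = IsComponent G ⊤ S

Odd : ℕ → Set
Odd k = k % 2 ≡ 1

IsTSpanning : ∀ {n m} → Graph n m → Subset n → Subset m → Set
IsTSpanning G T F = ∀ S → IsComponent G F S →
  Odd ∣ S ∩ T ∣ ⊎ ((S ∩ T ≡ ⊥) × IsComponentOfG G S)

Feasible : ∀ {n m} → Graph n m → Subset n → Subset m → Set
Feasible G T F = IsTSpanning G T F × IsForest G F

_△_ : ∀ {m} → Subset m → Subset m → Subset m
A △ B = zipWith _xor_ A B

DeltaGraphicFamily : ∀ {m} → (Subset m → Set) → Set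
DeltaGraphicFamily {m} 𝓑 = ∃[ n ] Σ (Graph n m) λ G → ∃[ T ] ∃[ X ]
  (∀ B → 𝓑 B ⇔ (∃[ F ] (Feasible G T F × B ≡ F △ X)))

DeltaGraphic : ∀ {m} → Matroid m → Set
DeltaGraphic M = DeltaGraphicFamily (Base M)

-- Complementing F △ X complements X, so the same graft with X replaced by
-- its complement represents the complementary family; the bases of M* are
-- exactly the complements of the bases of M.

module Submission where

open import Defs
open import Data.Nat using (ℕ)
open import Data.Bool.Properties using (not-involutive; not-distribʳ-xor)
open import Data.Vec using ([]; _∷_)
open import Data.Fin.Subset using (Subset; ∁)
open import Data.Product using (_,_; map₂)
open import Function using (_∘_)
open import Function.Bundles using (_⇔_; mk⇔; Equivalence)
import Function.Properties.Equivalence as ⇔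
open import Relation.Binary.PropositionalEquality using (_≡_; refl; sym; cong; cong₂; module ≡-Reasoning)

∁-involutive : ∀ {k} (p : Subset k) → ∁ (∁ p) ≡ p
∁-involutive []      = refl
∁-involutive (x ∷ p) = cong₂ _∷_ (not-involutive x) (∁-involutive p)

∁-△ʳ : ∀ {k} (p q : Subset k) → ∁ (p △ q) ≡ p △ ∁ q
∁-△ʳ []      []      = refl
∁-△ʳ (x ∷ p) (y ∷ q) = cong₂ _∷_ (not-distribʳ-xor x y) (∁-△ʳ p q)

∁≡△⇔≡△∁ : ∀ {k} (B F X : Subset k) → (∁ B ≡ F △ X) ⇔ (B ≡ F △ ∁ X)
∁≡△⇔≡△∁ B F X = mk⇔ to from
  where
  open ≡-Reasoning

  to : ∁ B ≡ F △ X → B ≡ F △ ∁ X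
  to e = begin
    B             ≡⟨ sym (∁-involutive B) ⟩
    ∁ (∁ B)       ≡⟨ cong ∁ e ⟩
    ∁ (F △ X)     ≡⟨ ∁-△ʳ F X ⟩
    F △ ∁ X       ∎

  from : B ≡ F △ ∁ X → ∁ B ≡ F △ X
  from e = begin
    ∁ B           ≡⟨ cong ∁ e ⟩
    ∁ (F △ ∁ X)   ≡⟨ ∁-△ʳ F (∁ X) ⟩
    F △ ∁ (∁ X)   ≡⟨ cong (F △_) (∁-involutive X) ⟩
    F △ X         ∎

deltaGraphicFamily-∁ : ∀ {m} {𝓑 : Subset m → Set} →
                       DeltaGraphicFamily 𝓑 → DeltaGraphicFamily (𝓑 ∘ ∁)
deltaGraphicFamily-∁ (n , G , T , X , 𝓑⇔) = n , G , T , ∁ X , λ B →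
  ⇔.trans (𝓑⇔ (∁ B)) (mk⇔ (map₂ (map₂ (Equivalence.to   (∁≡△⇔≡△∁ B _ X))))
                          (map₂ (map₂ (Equivalence.from (∁≡△⇔≡△∁ B _ X)))))

lemma3p1 : ∀ {m : ℕ} (M : Matroid m) → DeltaGraphic M → DeltaGraphicFamily (DualBase M)
lemma3p1 M = deltaGraphicFamily-∁
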